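{- Let $b \ge 3$ and $N \ge 1$ be integers, and let $x, y, r, s \in \{0, 1, \dots, b-2\}$ with $y > 0$. Then in base $b-1$, the integer $\{x,y\}_{b-1}$ is immediately followed by $\{r,s\}_{b-1}$ in a comma sequence if and only if, in base $b$, the integer $\{x+1,y\}_b$ is immediately followed by $\{r+1,s\}_b$ in a comma sequence.
   Context: For a base $c \ge 2$, a fixed integer $N \ge 1$, and digits $x, y \in \{0,\dots,c-1\}$, the notation $\{x,y\}_c$ denotes the integer whose base-$c$ representation is $N$ digits equal to $c-1$ followed by the digits $x, y$, i.e. $\{x,y\}_c = \sum_{i=2}^{N+1}(c-1)c^i + xc + y$ (the same $N$ is used throughout). Comma sequence rule in base $c$: a term $a$ with least significant base-$c$ digit $x$ is immediately followed by $a + cx + y$, where $y \in \{0,\dots,c-1\}$ must equal the most significant base-$c$ digit of $a + cx + y$ and is the smallest digit with this property; if no such $y$ exists, $a$ has no successor. -}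

module Defs where

open import Data.Nat using (ℕ; zero; suc; _+_; _*_; _∸_; _^_; _≤_; _<_)
open import Data.Nat.DivMod using (_%_)
open import Data.Product using (Σ; ∃; _×_)
open import Relation.Nullary using (¬_)
open import Relation.Binary.PropositionalEquality using (_≡_)

-- least significant base-c digit of a (only meaningful for c ≥ 2)
lsd : ℕ → ℕ → ℕ
lsd zero    a = a
lsd (suc c) a = a % suc c

IsMSD : ℕ → ℕ → ℕ → Set
IsMSD c n d = 0 < d × d < c × ∃ λ k → d * c ^ k ≤ n × n < suc d * c ^ k

-- Σ_{i=2}^{N+1} (c-1) c^i   (the block of N digits equal to c-1)
nines : ℕ → ℕ → ℕ
nines c zero    = 0
nines c (suc n) = nines c n + (c ∸ 1) * c ^ (suc (suc n))

-- {x,y}_c with N leading digits c-1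
brace : ℕ → ℕ → ℕ → ℕ → ℕ
brace c N x y = nines c N + x * c + y

-- comma-sequence successor rule in base c: with x = lsd a, the successor is
-- a + c x + y for the smallest digit y equal to the msd of a + c x + y
Follows : ℕ → ℕ → ℕ → Set
Follows c a a' =
  Σ ℕ λ y → y < c
    × a' ≡ a + c * lsd c a + y
    × IsMSD c (a + c * lsd c a + y) y
    × (∀ y' → y' < y → ¬ IsMSD c (a + c * lsd c a + y') y')

-- The leading block of N ≥ 1 digits c−1 forces the most significant digit of every
-- number in play to be c−1, so a term {q,u}_c followed by {r,s}_c must use y = c−1,
-- and minimality of y is automatic. The rule then reduces to the digit equation
-- (q+u)c + u + (c−1) = rc + s, i.e. r = q+u+1 and s = u−1 when u ≥ 1. Raising the
-- base by one and shifting q and r by one leaves this pair of equations unchanged.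
module Submission where

open import Defs
open import Data.Nat using (ℕ; zero; suc; _+_; _*_; _∸_; _^_; _%_; _≤_; _<_; z≤n; s≤s; s≤s⁻¹; NonZero)
open import Data.Nat.Properties
open import Data.Nat.DivMod using (%-remove-+ˡ; m<n⇒m%n≡m; [m+kn]%n≡m%n)
open import Data.Nat.Divisibility using (_∣_; _∣0; n∣m*n; m∣m*n; ∣-trans; ∣m∣n⇒∣m+n)
open import Data.Nat.Tactic.RingSolver using (solve-∀)
open import Data.Product using (_×_; _,_; proj₁; proj₂)
open import Function.Bundles using (_⇔_; mk⇔)
open import Function.Properties.Equivalence using () renaming (trans to ⇔-trans; sym to ⇔-sym)
open import Relation.Nullary using (¬_)
open import Relation.Binary.PropositionalEquality

divMod-unique : ∀ {c q t q′ t′} .{{_ : NonZero c}} → t < c → t′ < c →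
                q * c + t ≡ q′ * c + t′ → q ≡ q′ × t ≡ t′
divMod-unique {c} {q} {t} {q′} {t′} t<c t′<c eq = quot , rem
  where
  remainder : ∀ {q t} → t < c → (q * c + t) % c ≡ t
  remainder {q} {t} t<c = begin
    (q * c + t) % c ≡⟨ cong (_% c) (+-comm (q * c) t) ⟩
    (t + q * c) % c ≡⟨ [m+kn]%n≡m%n t q c ⟩
    t % c           ≡⟨ m<n⇒m%n≡m t<c ⟩
    t               ∎
    where open ≡-Reasoning
  rem : t ≡ t′
  rem = trans (sym (remainder {q} t<c)) (trans (cong (_% c) eq) (remainder {q′} t′<c))
  quot : q ≡ q′
  quot = *-cancelʳ-≡ q q′ c
           (+-cancelʳ-≡ t′ (q * c) (q′ * c) (subst (λ z → q * c + z ≡ q′ * c + t′) rem eq))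

power-bracket-unique : ∀ c .{{_ : NonZero c}} {n k j} →
                       c ^ k ≤ n → n < c ^ suc k → c ^ j ≤ n → n < c ^ suc j → k ≡ j
power-bracket-unique c {n} lo hi lo′ hi′ =
  ≤-antisym (≮⇒≥ (not-below lo hi′)) (≮⇒≥ (not-below lo′ hi))
  where
  not-below : ∀ {k j} → c ^ j ≤ n → n < c ^ suc k → ¬ k < j
  not-below lo hi k<j = <-irrefl refl (<-≤-trans hi (≤-trans (^-monoʳ-≤ c k<j) lo))

IsMSD⇒power-bracket : ∀ {c n d k} → 0 < d → d < c →
                      d * c ^ k ≤ n → n < suc d * c ^ k → c ^ k ≤ n × n < c ^ suc k
IsMSD⇒power-bracket {c} {k = k} (s≤s z≤n) d<c lo hi =
  ≤-trans (m≤m+n (c ^ k) _) lo , <-≤-trans hi (*-monoˡ-≤ (c ^ k) d<c)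

IsMSD-unique : ∀ {c n d e} .{{_ : NonZero c}} → IsMSD c n d → IsMSD c n e → d ≡ e
IsMSD-unique {c} (0<d , d<c , k , lo , hi) (0<e , e<c , j , lo′ , hi′)
  with c^k≤n , n<c^k+1 ← IsMSD⇒power-bracket {k = k} 0<d d<c lo hi
     | c^j≤n , n<c^j+1 ← IsMSD⇒power-bracket {k = j} 0<e e<c lo′ hi′
  with refl ← power-bracket-unique c {k = k} {j} c^k≤n n<c^k+1 c^j≤n n<c^j+1 =
  ≤-antisym (s≤s⁻¹ (*-cancelʳ-< _ _ _ (≤-<-trans lo hi′)))
            (s≤s⁻¹ (*-cancelʳ-< _ _ _ (≤-<-trans lo′ hi)))

nines-+-square : ∀ k n → nines (suc k) n + suc k * suc k ≡ suc k ^ suc (suc n)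
nines-+-square k zero = cong (suc k *_) (sym (*-identityʳ (suc k)))
nines-+-square k (suc n) = begin
  nines c n + k * c ^ suc (suc n) + c * c   ≡⟨ swap (nines c n) (k * c ^ suc (suc n)) (c * c) ⟩
  (nines c n + c * c) + k * c ^ suc (suc n) ≡⟨ cong (_+ k * c ^ suc (suc n)) (nines-+-square k n) ⟩
  c ^ suc (suc n) + k * c ^ suc (suc n)     ∎
  where
  open ≡-Reasoning
  c = suc k
  swap : ∀ a b d → a + b + d ≡ (a + d) + b
  swap = solve-∀

nines-divisible : ∀ c n → c ∣ nines c n
nines-divisible c zero    = c ∣0
nines-divisible c (suc n) =
  ∣m∣n⇒∣m+n (nines-divisible c n) (∣-trans (m∣m*n (c ^ suc n)) (n∣m*n (c ∸ 1)))

lsd-brace : ∀ k N q u → u < suc k → lsd (suc k) (brace (suc k) N q u) ≡ u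
lsd-brace k N q u u<c =
  trans (%-remove-+ˡ u (∣m∣n⇒∣m+n (nines-divisible (suc k) N) (n∣m*n q))) (m<n⇒m%n≡m u<c)

-- The block of digits c−1 spans positions 2 … n+2, so adding anything below c² keeps
-- the number in [(c−1)·c^(n+2), c^(n+3)).
IsMSD-nines : ∀ k n t → t < suc (suc k) * suc (suc k) →
              IsMSD (suc (suc k)) (nines (suc (suc k)) (suc n) + t) (suc k)
IsMSD-nines k n t t<c² = s≤s z≤n , ≤-refl , suc (suc n) , lower , upper
  where
  c = suc (suc k)
  lower : suc k * c ^ suc (suc n) ≤ nines c (suc n) + t
  lower = ≤-trans (m≤n+m _ (nines c n)) (m≤m+n _ t)
  upper : nines c (suc n) + t < c * c ^ suc (suc n)
  upper = subst (nines c (suc n) + t <_) (nines-+-square (suc k) (suc n)) (+-monoʳ-< _ t<c²)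

digits<square : ∀ {c r s} → r < c → s < c → r * c + s < c * c
digits<square {c} {r} r<c s<c =
  <-≤-trans (+-monoʳ-< (r * c) s<c) (subst (_≤ c * c) (+-comm c (r * c)) (*-monoˡ-≤ c r<c))

Follows-IsMSD⇔ : ∀ {c a a′ d} .{{_ : NonZero c}} → IsMSD c a′ d →
                 Follows c a a′ ⇔ (a′ ≡ a + c * lsd c a + d
                                   × ∀ y → y < d → ¬ IsMSD c (a + c * lsd c a + y) y)
Follows-IsMSD⇔ {c} {a} {a′} {d} msd = mk⇔ to from
  where
  Minimal = ∀ y → y < d → ¬ IsMSD c (a + c * lsd c a + y) y
  to : Follows c a a′ → a′ ≡ a + c * lsd c a + d × Minimal
  to (y , _ , eq , msd-y , minimal)
    with refl ← IsMSD-unique (subst (λ z → IsMSD c z y) (sym eq) msd-y) msd = eq , minimal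
  from : a′ ≡ a + c * lsd c a + d × Minimal → Follows c a a′
  from (eq , minimal) = d , proj₁ (proj₂ msd) , eq , subst (λ z → IsMSD c z d) eq msd , minimal

brace-successor-candidate : ∀ k N q u y → u < suc (suc k) →
  let c = suc (suc k); a = brace c N q u in
  a + c * lsd c a + y ≡ nines c N + ((q + u) * c + u + y)
brace-successor-candidate k N q u y u<c = begin
  a + c * lsd c a + y             ≡⟨ cong (λ z → a + c * z + y) (lsd-brace (suc k) N q u u<c) ⟩
  a + c * u + y                   ≡⟨ regroup (nines c N) q c u y ⟩
  nines c N + ((q + u) * c + u + y) ∎
  where
  open ≡-Reasoning
  c = suc (suc k)
  a = brace c N q u
  regroup : ∀ m q c u y → m + q * c + u + c * u + y ≡ m + ((q + u) * c + u + y)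
  regroup = solve-∀

-- For N ≥ 1 the successor digit is forced to be c−1.
Follows-brace⇔ : ∀ k n q u r s → u < suc (suc k) → r < suc (suc k) → s < suc (suc k) →
  let c = suc (suc k) in
  Follows c (brace c (suc n) q u) (brace c (suc n) r s) ⇔ (q + u) * c + u + suc k ≡ r * c + s
Follows-brace⇔ k n q u r s u<c r<c s<c = ⇔-trans (Follows-IsMSD⇔ {a = a} msd-rs) (mk⇔ to from)
  where
  c = suc (suc k)
  a = brace c (suc n) q u
  T = (q + u) * c + u
  candidate : ∀ y → a + c * lsd c a + y ≡ nines c (suc n) + (T + y)
  candidate = λ y → brace-successor-candidate k (suc n) q u y u<c
  brace-rs : brace c (suc n) r s ≡ nines c (suc n) + (r * c + s)
  brace-rs = +-assoc (nines c (suc n)) (r * c) s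
  rs<c² : r * c + s < c * c
  rs<c² = digits<square r<c s<c
  msd-rs : IsMSD c (brace c (suc n) r s) (suc k)
  msd-rs = subst (λ z → IsMSD c z (suc k)) (sym brace-rs) (IsMSD-nines k n _ rs<c²)
  Minimal = ∀ y → y < suc k → ¬ IsMSD c (a + c * lsd c a + y) y
  to : brace c (suc n) r s ≡ a + c * lsd c a + suc k × Minimal → T + suc k ≡ r * c + s
  to (eq , _) = sym (+-cancelˡ-≡ (nines c (suc n)) _ _
                  (trans (sym brace-rs) (trans eq (candidate (suc k)))))
  from : T + suc k ≡ r * c + s → brace c (suc n) r s ≡ a + c * lsd c a + suc k × Minimal
  from E = trans brace-rs (trans (cong (nines c (suc n) +_) (sym E)) (sym (candidate (suc k))))
         , minimal
    where
    minimal : Minimal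
    minimal y y<k msd-y = <⇒≢ y<k (IsMSD-unique (subst (λ z → IsMSD c z y) (candidate y) msd-y)
                            (IsMSD-nines k n _ (<-trans (subst (T + y <_) E (+-monoʳ-< T y<k)) rs<c²)))

-- u + (c−1) = c + (u−1): the carry out of the last digit.
carry-digits⇔ : ∀ k q v r s → v < suc (suc k) → s < suc (suc k) →
  let c = suc (suc k) in
  (q + suc v) * c + suc v + suc k ≡ r * c + s ⇔ (r ≡ suc (q + suc v) × s ≡ v)
carry-digits⇔ k q v r s v<c s<c = mk⇔
  (λ E → divMod-unique s<c v<c (trans (sym E) (carry k q v)))
  (λ { (refl , refl) → carry k q v })
  where
  carry : ∀ k q v → (q + suc v) * suc (suc k) + suc v + suc k ≡ suc (q + suc v) * suc (suc k) + v
  carry = solve-∀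

Follows-brace-digits⇔ : ∀ k n q v r s → suc v < suc (suc k) → r < suc (suc k) → s < suc (suc k) →
  let c = suc (suc k) in
  Follows c (brace c (suc n) q (suc v)) (brace c (suc n) r s) ⇔ (r ≡ suc (q + suc v) × s ≡ v)
Follows-brace-digits⇔ k n q v r s 1+v<c r<c s<c =
  ⇔-trans (Follows-brace⇔ k n q (suc v) r s 1+v<c r<c s<c)
          (carry-digits⇔ k q v r s (<-trans (n<1+n v) 1+v<c) s<c)

lemma3 : ∀ (b N x y r s : ℕ) → 3 ≤ b → 1 ≤ N
    → x ≤ b ∸ 2 → y ≤ b ∸ 2 → r ≤ b ∸ 2 → s ≤ b ∸ 2 → 0 < y
    → Follows (b ∸ 1) (brace (b ∸ 1) N x y) (brace (b ∸ 1) N r s)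
    ⇔ Follows b (brace b N (suc x) y) (brace b N (suc r) s)
lemma3 (suc (suc (suc m))) (suc n) x (suc v) r s _ _ _ y≤b-2 r≤b-2 s≤b-2 _ =
  ⇔-trans (Follows-brace-digits⇔ m n x v r s (s≤s y≤b-2) (s≤s r≤b-2) (s≤s s≤b-2))
  (⇔-trans suc-≡⇔
  (⇔-sym (Follows-brace-digits⇔ (suc m) n (suc x) v (suc r) s
            (s≤s (m≤n⇒m≤1+n y≤b-2)) (s≤s (s≤s r≤b-2)) (s≤s (m≤n⇒m≤1+n s≤b-2)))))
  where
  suc-≡⇔ : ∀ {p q t w : ℕ} → (p ≡ q × t ≡ w) ⇔ (suc p ≡ suc q × t ≡ w)
  suc-≡⇔ = mk⇔ (λ (p≡q , t≡w) → cong suc p≡q , t≡w) (λ (p≡q , t≡w) → suc-injective p≡q , t≡w)
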